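{- Let $a \geq 1$ be a real number and let $\mathbf{d}=(d_1,\ldots,d_m)$ be a list of non-negative integers with $d_1\geq d_2\geq\cdots\geq d_m$ and $$d_1\leq\min\left\{a d_m,\ \frac{4am}{(a+1)^2}\right\}.$$ Then there exists a simple bipartite graph with $m$ vertices on each side whose degree sequence on each of the two sides is $\mathbf{d}$. In particular, this holds whenever $d_1 \leq \min\{2d_m, \frac{8m}{9}\}$.
   Formalization: The parameter a ranges over the rationals with a ≥ 1 rather than over the real numbers. -}

module Defs where

open import Data.Nat using (ℕ; zero; suc; _+_)
open import Data.Bool using (Bool; true; false)
open import Data.Fin using (Fin; zero; suc)
open import Data.Integer using (+_)
open import Data.Rational using (ℚ; _/_)

count : {m : ℕ} → (Fin m → Bool) → ℕ
count {zero}  p = 0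
count {suc m} p = (if p zero then 1 else 0) + count {m} (λ j → p (suc j))
  where open import Data.Bool using (if_then_else_)

ℕtoℚ : ℕ → ℚ
ℕtoℚ n = (+ n) / 1

-- A simple bipartite graph with parts L = Fin m and R = Fin m is given by its
-- biadjacency relation E : Fin m → Fin m → Bool (E i j = true iff left vertex i
-- is adjacent to right vertex j).  Simplicity (no multi-edges) is built in;
-- loops are impossible in a bipartite graph.
BipartiteGraph : ℕ → Set
BipartiteGraph m = Fin m → Fin m → Bool

degL : {m : ℕ} → BipartiteGraph m → Fin m → ℕ
degL E i = count (λ j → E i j)

degR : {m : ℕ} → BipartiteGraph m → Fin m → ℕ
degR E j = count (λ i → E i j)

HasBidegrees : {m : ℕ} → BipartiteGraph m → (Fin m → ℕ) → Set
HasBidegrees {m} E d = ((i : Fin m) → degL E i ≡ d i) × ((j : Fin m) → degR E j ≡ d j)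
  where
    open import Relation.Binary.PropositionalEquality using (_≡_)
    open import Data.Product using (_×_)

NonIncreasing : {m : ℕ} → (Fin m → ℕ) → Set
NonIncreasing {m} d = (i j : Fin m) → i Data.Fin.≤ j → d j Data.Nat.≤ d i
  where import Data.Fin ; import Data.Nat

-- By the Gale–Ryser theorem, a 0-1 matrix with row sums r and non-increasing column sums c
-- exists iff the totals agree and every prefix sum c₁ + … + c_q is at most Σᵢ min(rᵢ, q).
-- For r = c = d this is checked by splitting Σᵢ min(dᵢ, q) at row q: the first q rows lose at
-- most q(Δ − q) against their degrees, the remaining m − q rows gain at least (m − q) min(δ, q),
-- where Δ = d₁ and δ = d_m; AM-GM turns (Δ + δ)² ≤ 4δm into q(Δ − q) ≤ (m − q) δ.  The
-- hypotheses of the theorem give (Δ + δ)² ≤ 4δm through the identity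
-- a(Δ + δ)² + (aδ − Δ)(aΔ − δ) = Δδ(a + 1)².
module Submission where

open import Defs
open import Data.Nat using (ℕ; suc)
open import Data.Fin using (Fin; zero; fromℕ)
open import Data.Product using (Σ; _×_; _,_)
open import Data.Rational
  using (ℚ; _≤_; _*_; _+_; 1ℚ; 0ℚ; mkℚ; _/_; -_; *≤*; Positive; positive; nonNegative)
import Data.Nat as ℕ
open import Data.Integer using (+_; +≤+)
import Data.Integer as ℤ
import Data.Integer.Properties as ℤ
import Data.Rational.Properties as ℚ
open import Data.Rational.Solver using (module +-*-Solver)
import Data.Nat.Coprimality as Coprimality
open import Relation.Binary.PropositionalEquality using (_≡_; refl; sym; trans; cong; cong₂; subst₂)
open import Function using (_∘_)

module Realisation where

  open import Data.Bool using (Bool; true; false; if_then_else_; _≟_)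
  open import Data.Nat using (zero; _∸_; _⊓_; z≤n; s≤s; _<?_; _≤?_)
    renaming (_≤_ to _≤ℕ_; _<_ to _<ℕ_; _+_ to _+ℕ_; _*_ to _*ℕ_)
  open import Data.Nat.Properties hiding (_≟_)
  open import Data.Nat.Tactic.RingSolver using (solve-∀)
  open import Algebra.Properties.Semiring.Sum +-*-semiring using (sum; sum-cong-≗; *-distribʳ-sum)
  open import Algebra.Properties.CommutativeSemigroup +-commutativeSemigroup
    renaming (interchange to +-interchange)
  open import Data.Fin using (suc; toℕ) renaming (_≟_ to _≟ᶠ_)
  open import Data.Fin.Properties using (any?; ≤fromℕ)
  open import Data.Vec.Functional using (_∷_; updateAt)
  open import Data.Vec.Functional.Properties using (updateAt-updates; updateAt-minimal)
  open import Data.Product using (∃; proj₁; proj₂)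
  open import Data.Sum using (_⊎_; inj₁; inj₂)
  open import Function using (const)
  open import Relation.Nullary using (yes; no; contradiction)
  open import Relation.Nullary.Decidable using (_×-dec_)
  open import Relation.Binary.PropositionalEquality

  open ≤-Reasoning

  sum-mono-≤ : ∀ {m} {f g : Fin m → ℕ} → (∀ i → f i ≤ℕ g i) → sum f ≤ℕ sum g
  sum-mono-≤ {zero}  f≤g = z≤n
  sum-mono-≤ {suc m} f≤g = +-mono-≤ (f≤g zero) (sum-mono-≤ (f≤g ∘ suc))

  sum-mono-< : ∀ {m} {f g : Fin m → ℕ} → (∀ i → f i ≤ℕ g i) → ∀ i → f i <ℕ g i → sum f <ℕ sum g
  sum-mono-< f≤g zero    fi<gi = +-mono-<-≤ fi<gi (sum-mono-≤ (f≤g ∘ suc))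
  sum-mono-< f≤g (suc i) fi<gi = +-mono-≤-< (f≤g zero) (sum-mono-< (f≤g ∘ suc) i fi<gi)

  sum-+ : ∀ {m} (f g : Fin m → ℕ) → sum (λ i → f i +ℕ g i) ≡ sum f +ℕ sum g
  sum-+ {zero}  f g = refl
  sum-+ {suc m} f g = trans (cong (f zero +ℕ g zero +ℕ_) (sum-+ (f ∘ suc) (g ∘ suc)))
                            (+-interchange (f zero) (g zero) _ _)

  sum-const : ∀ m x → sum {m} (const x) ≡ m *ℕ x
  sum-const zero    x = refl
  sum-const (suc m) x = cong (x +ℕ_) (sum-const m x)

  sum≡0⇒≡0 : ∀ {m} (f : Fin m → ℕ) → sum f ≡ 0 → ∀ i → f i ≡ 0
  sum≡0⇒≡0 f Σf≡0 zero    = m+n≡0⇒m≡0 (f zero) Σf≡0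
  sum≡0⇒≡0 f Σf≡0 (suc i) = sum≡0⇒≡0 (f ∘ suc) (m+n≡0⇒n≡0 (f zero) Σf≡0) i

  indicator : Bool → ℕ
  indicator b = if b then 1 else 0

  count≡sum : ∀ {m} (S : Fin m → Bool) → count S ≡ sum (indicator ∘ S)
  count≡sum {zero}  S = refl
  count≡sum {suc m} S = cong (indicator (S zero) +ℕ_) (count≡sum (S ∘ suc))

  count-none : ∀ m → count {m} (const false) ≡ 0
  count-none zero    = refl
  count-none (suc m) = count-none m

  count-all : ∀ {m} (S : Fin m → Bool) → (∀ i → S i ≡ true) → count S ≡ m
  count-all {zero}  S all = refl
  count-all {suc m} S all rewrite all zero = cong suc (count-all (S ∘ suc) (all ∘ suc))

  count-updateAt : ∀ {m} (S : Fin m → Bool) j → S j ≡ false →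
                   count (updateAt S j (const true)) ≡ suc (count S)
  count-updateAt S zero    Sj rewrite Sj = refl
  count-updateAt S (suc j) Sj = trans (cong (indicator (S zero) +ℕ_) (count-updateAt (S ∘ suc) j Sj))
                                      (+-suc (indicator (S zero)) _)

  -- Beyond the last index the prefix sum is the full sum.
  prefixSum : ∀ {k} → (Fin k → ℕ) → ℕ → ℕ
  prefixSum         c zero    = 0
  prefixSum {zero}  c (suc q) = 0
  prefixSum {suc k} c (suc q) = c zero +ℕ prefixSum (c ∘ suc) q

  prefixSum-≤ : ∀ {k} {c : Fin k → ℕ} {b} q → (∀ j → c j ≤ℕ b) → prefixSum c q ≤ℕ q *ℕ b
  prefixSum-≤         zero    c≤b = z≤n
  prefixSum-≤ {zero}  (suc q) c≤b = z≤n
  prefixSum-≤ {suc k} (suc q) c≤b = +-mono-≤ (c≤b zero) (prefixSum-≤ q (c≤b ∘ suc))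

  prefixSum-split : ∀ {m} q {f g : Fin m → ℕ} {x y} →
                    (∀ i → toℕ i <ℕ q → f i ≤ℕ g i +ℕ y) → (∀ i → q ≤ℕ toℕ i → x ≤ℕ g i) →
                    prefixSum f q +ℕ (m ∸ q) *ℕ x ≤ℕ sum g +ℕ (m ⊓ q) *ℕ y
  prefixSum-split {zero}  zero    _ _ = z≤n
  prefixSum-split {zero}  (suc q) _ _ = z≤n
  prefixSum-split {suc m} zero {g = g} {x} _ x≤g = begin
    suc m *ℕ x              ≡⟨ sum-const (suc m) x ⟨
    sum {suc m} (const x)   ≤⟨ sum-mono-≤ (λ i → x≤g i z≤n) ⟩
    sum g                   ≡⟨ +-identityʳ (sum g) ⟨
    sum g +ℕ 0              ∎
  prefixSum-split {suc m} (suc q) {f} {g} {x} {y} f≤g+y x≤g = begin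
    f zero +ℕ prefixSum (f ∘ suc) q +ℕ (m ∸ q) *ℕ x
      ≡⟨ +-assoc (f zero) _ _ ⟩
    f zero +ℕ (prefixSum (f ∘ suc) q +ℕ (m ∸ q) *ℕ x)
      ≤⟨ +-mono-≤ (f≤g+y zero (s≤s z≤n))
                  (prefixSum-split q (λ i → f≤g+y (suc i) ∘ s≤s) (λ i → x≤g (suc i) ∘ s≤s)) ⟩
    g zero +ℕ y +ℕ (sum (g ∘ suc) +ℕ (m ⊓ q) *ℕ y)
      ≡⟨ +-interchange (g zero) y _ _ ⟩
    sum g +ℕ suc (m ⊓ q) *ℕ y
      ∎

  TopSet : ∀ {m} → (Fin m → ℕ) → (Fin m → Bool) → Set
  TopSet r S = ∀ i j → S i ≡ true → S j ≡ false → r j ≤ℕ r i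

  all⊎maximal-unselected : ∀ {m} (r : Fin m → ℕ) (S : Fin m → Bool) →
    (∀ i → S i ≡ true) ⊎ ∃ λ j → S j ≡ false × (∀ i → S i ≡ false → r i ≤ℕ r j)
  all⊎maximal-unselected {zero} r S = inj₁ λ ()
  all⊎maximal-unselected {suc m} r S
    with all⊎maximal-unselected (r ∘ suc) (S ∘ suc) | S zero in S₀
  ... | inj₁ all | true  = inj₁ λ { zero → S₀ ; (suc i) → all i }
  ... | inj₁ all | false = inj₂ (zero , S₀ , λ
          { zero    _   → ≤-refl
          ; (suc i) Sᵢ → contradiction (trans (sym (all i)) Sᵢ) λ () })
  ... | inj₂ (j , Sⱼ , max) | true = inj₂ (suc j , Sⱼ , λ
          { zero    S₀′ → contradiction (trans (sym S₀) S₀′) λ ()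
          ; (suc i) Sᵢ  → max i Sᵢ })
  ... | inj₂ (j , Sⱼ , max) | false with r zero ≤? r (suc j)
  ...   | yes r₀≤ = inj₂ (suc j , Sⱼ , λ { zero _ → r₀≤ ; (suc i) Sᵢ → max i Sᵢ })
  ...   | no r₀≰  = inj₂ (zero , S₀ , λ
          { zero    _  → ≤-refl
          ; (suc i) Sᵢ → ≤-trans (max i Sᵢ) (<⇒≤ (≰⇒> r₀≰)) })

  top-set : ∀ {m} (r : Fin m → ℕ) p → p ≤ℕ m → Σ (Fin m → Bool) λ S → count S ≡ p × TopSet r S
  top-set {m} r zero    _   = const false , count-none m , λ _ _ ()
  top-set {m} r (suc p) p<m with top-set r p (<⇒≤ p<m)
  ... | S , |S|≡p , top with all⊎maximal-unselected r S
  ...   | inj₁ all = contradiction (subst (_<ℕ m) (trans (sym |S|≡p) (count-all S all)) p<m) (<-irrefl refl)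
  ...   | inj₂ (j , Sⱼ , max) = S′ , trans (count-updateAt S j Sⱼ) (cong suc |S|≡p) , top′
    where
    S′ : Fin m → Bool
    S′ = updateAt S j (const true)

    unselected : ∀ k → S′ k ≡ false → S k ≡ false
    unselected k S′ₖ with k ≟ᶠ j
    ... | yes refl = contradiction (trans (sym (updateAt-updates j S)) S′ₖ) λ ()
    ... | no k≢j   = trans (sym (updateAt-minimal k j S k≢j)) S′ₖ

    top′ : TopSet r S′
    top′ i k S′ᵢ S′ₖ with i ≟ᶠ j
    ... | yes refl = max k (unselected k S′ₖ)
    ... | no i≢j   = top i k (trans (sym (updateAt-minimal i j S i≢j)) S′ᵢ) (unselected k S′ₖ)

  -- If a selected row were empty, all unselected rows would be empty as well.
  top-set-positive : ∀ {m} {r : Fin m → ℕ} {S : Fin m → Bool} → TopSet r S →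
                     count S ≤ℕ sum (λ i → r i ⊓ 1) → ∀ i → S i ≡ true → 1 ≤ℕ r i
  top-set-positive {r = r} {S} top |S|≤ i Sᵢ with r i in rᵢ≡
  ... | suc _ = s≤s z≤n
  ... | zero  = contradiction |S|≤ (<⇒≱ (begin-strict
      sum (λ j → r j ⊓ 1)   <⟨ sum-mono-< bounded i (subst₂ (λ a b → a ⊓ 1 <ℕ indicator b) (sym rᵢ≡) (sym Sᵢ) (s≤s z≤n)) ⟩
      sum (indicator ∘ S)   ≡⟨ count≡sum S ⟨
      count S               ∎))
    where
    bounded : ∀ j → r j ⊓ 1 ≤ℕ indicator (S j)
    bounded j with S j in Sⱼ
    ... | true  = m⊓n≤n (r j) 1
    ... | false = ≤-trans (m⊓n≤m (r j) 1) (≤-trans (top i j Sᵢ Sⱼ) (≤-reflexive rᵢ≡))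

  GaleRyser : ∀ {m k} → (Fin m → ℕ) → (Fin k → ℕ) → Set
  GaleRyser r c = ∀ q → prefixSum c q ≤ℕ sum (λ i → r i ⊓ q)

  HasMargins : ∀ {m k} → (Fin m → Fin k → Bool) → (Fin m → ℕ) → (Fin k → ℕ) → Set
  HasMargins M r c = (∀ i → count (M i) ≡ r i) × (∀ j → count (λ i → M i j) ≡ c j)

  -- Filling the first column on the c₀ rows of largest demand preserves the Gale–Ryser condition.
  module ColumnPeeling {m k} (r : Fin m → ℕ) (c : Fin (suc k) → ℕ)
                       (c↓ : NonIncreasing c) (gr : GaleRyser r c) where

    c₀≤Σ[r⊓1] : c zero ≤ℕ sum (λ i → r i ⊓ 1)
    c₀≤Σ[r⊓1] = subst (_≤ℕ _) (+-identityʳ (c zero)) (gr 1)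

    c₀≤m : c zero ≤ℕ m
    c₀≤m = begin
      c zero                 ≤⟨ c₀≤Σ[r⊓1] ⟩
      sum (λ i → r i ⊓ 1)    ≤⟨ sum-mono-≤ (λ i → m⊓n≤n (r i) 1) ⟩
      sum {m} (const 1)      ≡⟨ sum-const m 1 ⟩
      m *ℕ 1                 ≡⟨ *-identityʳ m ⟩
      m                      ∎

    S : Fin m → Bool
    S = proj₁ (top-set r (c zero) c₀≤m)

    |S|≡c₀ : count S ≡ c zero
    |S|≡c₀ = proj₁ (proj₂ (top-set r (c zero) c₀≤m))

    S-top : TopSet r S
    S-top = proj₂ (proj₂ (top-set r (c zero) c₀≤m))

    Σ[S]≡c₀ : sum (indicator ∘ S) ≡ c zero
    Σ[S]≡c₀ = trans (sym (count≡sum S)) |S|≡c₀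

    S-positive : ∀ i → S i ≡ true → 1 ≤ℕ r i
    S-positive = top-set-positive S-top (subst (_≤ℕ _) (sym |S|≡c₀) c₀≤Σ[r⊓1])

    r′ : Fin m → ℕ
    r′ i = r i ∸ indicator (S i)

    r≡ : ∀ i → indicator (S i) +ℕ r′ i ≡ r i
    r≡ i with S i in Sᵢ
    ... | true  = m+[n∸m]≡n (S-positive i Sᵢ)
    ... | false = refl

    Σc′≡Σr′ : sum c ≡ sum r → sum (c ∘ suc) ≡ sum r′
    Σc′≡Σr′ Σc≡Σr = +-cancelˡ-≡ (c zero) _ _ (begin-equality
      c zero +ℕ sum (c ∘ suc)               ≡⟨ Σc≡Σr ⟩
      sum r                                 ≡⟨ sum-cong-≗ r≡ ⟨
      sum (λ i → indicator (S i) +ℕ r′ i)   ≡⟨ sum-+ (indicator ∘ S) r′ ⟩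
      sum (indicator ∘ S) +ℕ sum r′         ≡⟨ cong (_+ℕ sum r′) Σ[S]≡c₀ ⟩
      c zero +ℕ sum r′                      ∎)

    -- An unselected row above q forces every selected row to keep at least q after peeling.
    gr′-above : ∀ q j → S j ≡ false → q <ℕ r j → prefixSum (c ∘ suc) q ≤ℕ sum (λ i → r′ i ⊓ q)
    gr′-above q j Sⱼ q<rⱼ = begin
      prefixSum (c ∘ suc) q       ≤⟨ prefixSum-≤ q (λ j → c↓ zero (suc j) z≤n) ⟩
      q *ℕ c zero                 ≡⟨ *-comm q (c zero) ⟩
      c zero *ℕ q                 ≡⟨ cong (_*ℕ q) Σ[S]≡c₀ ⟨
      sum (indicator ∘ S) *ℕ q    ≡⟨ *-distribʳ-sum q (indicator ∘ S) ⟩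
      sum (λ i → indicator (S i) *ℕ q)
                                  ≤⟨ sum-mono-≤ selected≥q ⟩
      sum (λ i → r′ i ⊓ q)        ∎
      where
      selected≥q : ∀ i → indicator (S i) *ℕ q ≤ℕ r′ i ⊓ q
      selected≥q i with S i in Sᵢ
      ... | false = z≤n
      ... | true  = ≤-trans (≤-reflexive (+-identityʳ q))
                      (⊓-glb (∸-monoˡ-≤ 1 (≤-trans q<rⱼ (S-top i j Sᵢ Sⱼ))) ≤-refl)

    gr′-below : ∀ q → (∀ j → S j ≡ false → r j ≤ℕ q) → prefixSum (c ∘ suc) q ≤ℕ sum (λ i → r′ i ⊓ q)
    gr′-below q unselected≤q = +-cancelˡ-≤ (c zero) _ _ (begin
      c zero +ℕ prefixSum (c ∘ suc) q                ≤⟨ gr (suc q) ⟩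
      sum (λ i → r i ⊓ suc q)                        ≡⟨ sum-cong-≗ peel ⟩
      sum (λ i → indicator (S i) +ℕ r′ i ⊓ q)        ≡⟨ sum-+ (indicator ∘ S) (λ i → r′ i ⊓ q) ⟩
      sum (indicator ∘ S) +ℕ sum (λ i → r′ i ⊓ q)    ≡⟨ cong (_+ℕ sum (λ i → r′ i ⊓ q)) Σ[S]≡c₀ ⟩
      c zero +ℕ sum (λ i → r′ i ⊓ q)                 ∎)
      where
      peel : ∀ i → r i ⊓ suc q ≡ indicator (S i) +ℕ r′ i ⊓ q
      peel i with S i in Sᵢ
      ... | true  = cong (_⊓ suc q) (sym (m+[n∸m]≡n (S-positive i Sᵢ)))
      ... | false = trans (m≤n⇒m⊓n≡m (m≤n⇒m≤1+n (unselected≤q i Sᵢ)))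
                          (sym (m≤n⇒m⊓n≡m (unselected≤q i Sᵢ)))

    gr′ : GaleRyser r′ (c ∘ suc)
    gr′ q with any? (λ j → (S j ≟ false) ×-dec (q <? r j))
    ... | yes (j , Sⱼ , q<rⱼ) = gr′-above q j Sⱼ q<rⱼ
    ... | no ∄ = gr′-below q (λ j Sⱼ → ≮⇒≥ (λ q<rⱼ → ∄ (j , Sⱼ , q<rⱼ)))

  gale-ryser : ∀ {m k} (r : Fin m → ℕ) (c : Fin k → ℕ) → NonIncreasing c → sum c ≡ sum r →
               GaleRyser r c → Σ (Fin m → Fin k → Bool) λ M → HasMargins M r c
  gale-ryser {k = zero} r c _ Σc≡Σr _ =
    (λ _ ()) , (λ i → sym (sum≡0⇒≡0 r (sym Σc≡Σr) i)) , λ ()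
  gale-ryser {m} {suc k} r c c↓ Σc≡Σr gr =
    (λ i → S i ∷ M′ i) ,
    (λ i → trans (cong (indicator (S i) +ℕ_) (rows′ i)) (r≡ i)) ,
    λ { zero → |S|≡c₀ ; (suc j) → columns′ j }
    where
    open ColumnPeeling r c c↓ gr
    c′↓ : NonIncreasing (c ∘ suc)
    c′↓ i j = c↓ (suc i) (suc j) ∘ s≤s
    rest : Σ (Fin m → Fin k → Bool) λ M → HasMargins M r′ (c ∘ suc)
    rest = gale-ryser r′ (c ∘ suc) c′↓ (Σc′≡Σr′ Σc≡Σr) gr′
    M′ : Fin m → Fin k → Bool
    M′ = proj₁ rest
    rows′ : ∀ i → count (M′ i) ≡ r′ i
    rows′ = proj₁ (proj₂ rest)
    columns′ : ∀ j → count (λ i → M′ i j) ≡ c (suc j)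
    columns′ = proj₂ (proj₂ rest)

  am-gm : ∀ a b → 4 *ℕ a *ℕ b ≤ℕ (a +ℕ b) *ℕ (a +ℕ b)
  am-gm a b with ≤-total a b
  ... | inj₁ a≤b = subst (λ b → 4 *ℕ a *ℕ b ≤ℕ (a +ℕ b) *ℕ (a +ℕ b)) (m+[n∸m]≡n a≤b)
                    (≤-trans (m≤m+n _ _) (≤-reflexive (lower-first a (b ∸ a))))
    where
    lower-first : ∀ a t → 4 *ℕ a *ℕ (a +ℕ t) +ℕ t *ℕ t ≡ (a +ℕ (a +ℕ t)) *ℕ (a +ℕ (a +ℕ t))
    lower-first = solve-∀
  ... | inj₂ b≤a = subst (λ a → 4 *ℕ a *ℕ b ≤ℕ (a +ℕ b) *ℕ (a +ℕ b)) (m+[n∸m]≡n b≤a)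
                    (≤-trans (m≤m+n _ _) (≤-reflexive (lower-second b (a ∸ b))))
    where
    lower-second : ∀ b t → 4 *ℕ (b +ℕ t) *ℕ b +ℕ t *ℕ t ≡ (b +ℕ t +ℕ b) *ℕ (b +ℕ t +ℕ b)
    lower-second = solve-∀

  square-bound⇒≤ : ∀ {Δ δ m} → (Δ +ℕ δ) *ℕ (Δ +ℕ δ) ≤ℕ 4 *ℕ δ *ℕ m → Δ ≤ℕ m
  square-bound⇒≤ {zero}          _ = z≤n
  square-bound⇒≤ {suc Δ} {zero}  ()
  square-bound⇒≤ {suc Δ} {suc δ} {m} bound = *-cancelˡ-≤ 4 (*-cancelˡ-≤ (suc δ) (begin
    suc δ *ℕ (4 *ℕ suc Δ)              ≡⟨ *-comm (suc δ) _ ⟩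
    4 *ℕ suc Δ *ℕ suc δ                ≤⟨ am-gm (suc Δ) (suc δ) ⟩
    (suc Δ +ℕ suc δ) *ℕ (suc Δ +ℕ suc δ) ≤⟨ bound ⟩
    4 *ℕ suc δ *ℕ m                    ≡⟨ cong (_*ℕ m) (*-comm 4 (suc δ)) ⟩
    suc δ *ℕ 4 *ℕ m                    ≡⟨ *-assoc (suc δ) 4 m ⟩
    suc δ *ℕ (4 *ℕ m)                  ∎))

  -- Here Δ = q + e and m = q + w.
  excess-bound : ∀ q e w δ → (q +ℕ e +ℕ δ) *ℕ (q +ℕ e +ℕ δ) ≤ℕ 4 *ℕ δ *ℕ (q +ℕ w) → q *ℕ e ≤ℕ w *ℕ δ
  excess-bound q e w δ bound = *-cancelˡ-≤ 4 (+-cancelʳ-≤ (4 *ℕ (q *ℕ δ)) _ _ (begin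
    4 *ℕ (q *ℕ e) +ℕ 4 *ℕ (q *ℕ δ)      ≡⟨ factor q e δ ⟩
    4 *ℕ q *ℕ (e +ℕ δ)                  ≤⟨ am-gm q (e +ℕ δ) ⟩
    (q +ℕ (e +ℕ δ)) *ℕ (q +ℕ (e +ℕ δ))  ≡⟨ cong (λ s → s *ℕ s) (+-assoc q e δ) ⟨
    (q +ℕ e +ℕ δ) *ℕ (q +ℕ e +ℕ δ)      ≤⟨ bound ⟩
    4 *ℕ δ *ℕ (q +ℕ w)                  ≡⟨ expand q w δ ⟩
    4 *ℕ (w *ℕ δ) +ℕ 4 *ℕ (q *ℕ δ)      ∎))
    where
    factor : ∀ q e δ → 4 *ℕ (q *ℕ e) +ℕ 4 *ℕ (q *ℕ δ) ≡ 4 *ℕ q *ℕ (e +ℕ δ)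
    factor = solve-∀
    expand : ∀ q w δ → 4 *ℕ δ *ℕ (q +ℕ w) ≡ 4 *ℕ (w *ℕ δ) +ℕ 4 *ℕ (q *ℕ δ)
    expand = solve-∀

  excess≤slack : ∀ {m Δ δ} q → (Δ +ℕ δ) *ℕ (Δ +ℕ δ) ≤ℕ 4 *ℕ δ *ℕ m →
                 (m ⊓ q) *ℕ (Δ ∸ q) ≤ℕ (m ∸ q) *ℕ (δ ⊓ q)
  excess≤slack {m} {Δ} {δ} q bound with Δ ≤? q
  ... | yes Δ≤q = begin
    (m ⊓ q) *ℕ (Δ ∸ q)    ≡⟨ cong ((m ⊓ q) *ℕ_) (m≤n⇒m∸n≡0 Δ≤q) ⟩
    (m ⊓ q) *ℕ 0          ≡⟨ *-zeroʳ (m ⊓ q) ⟩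
    0                     ≤⟨ z≤n ⟩
    (m ∸ q) *ℕ (δ ⊓ q)    ∎
  ... | no Δ≰q = begin
    (m ⊓ q) *ℕ (Δ ∸ q)              ≡⟨ cong (_*ℕ (Δ ∸ q)) (m≥n⇒m⊓n≡n q≤m) ⟩
    q *ℕ (Δ ∸ q)                    ≤⟨ ⊓-glb (excess-bound q (Δ ∸ q) (m ∸ q) δ split-bound) excess≤[m∸q]q ⟩
    (m ∸ q) *ℕ δ ⊓ ((m ∸ q) *ℕ q)   ≡⟨ *-distribˡ-⊓ (m ∸ q) δ q ⟨
    (m ∸ q) *ℕ (δ ⊓ q)              ∎
    where
    q≤Δ : q ≤ℕ Δ
    q≤Δ = <⇒≤ (≰⇒> Δ≰q)
    Δ≤m : Δ ≤ℕ m
    Δ≤m = square-bound⇒≤ bound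
    q≤m : q ≤ℕ m
    q≤m = ≤-trans q≤Δ Δ≤m
    split-bound : (q +ℕ (Δ ∸ q) +ℕ δ) *ℕ (q +ℕ (Δ ∸ q) +ℕ δ) ≤ℕ 4 *ℕ δ *ℕ (q +ℕ (m ∸ q))
    split-bound = subst₂ (λ a b → (a +ℕ δ) *ℕ (a +ℕ δ) ≤ℕ 4 *ℕ δ *ℕ b)
                         (sym (m+[n∸m]≡n q≤Δ)) (sym (m+[n∸m]≡n q≤m)) bound
    excess≤[m∸q]q : q *ℕ (Δ ∸ q) ≤ℕ (m ∸ q) *ℕ q
    excess≤[m∸q]q = ≤-trans (≤-reflexive (*-comm q (Δ ∸ q))) (*-monoˡ-≤ q (∸-monoˡ-≤ q Δ≤m))

  degree-bound⇒gale-ryser : ∀ {n} {d : Fin (suc n) → ℕ} → NonIncreasing d →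
    (d zero +ℕ d (fromℕ n)) *ℕ (d zero +ℕ d (fromℕ n)) ≤ℕ 4 *ℕ d (fromℕ n) *ℕ suc n → GaleRyser d d
  degree-bound⇒gale-ryser {n} {d} d↓ bound q = +-cancelʳ-≤ ((suc n ∸ q) *ℕ (d (fromℕ n) ⊓ q)) _ _ (begin
    prefixSum d q +ℕ (suc n ∸ q) *ℕ (d (fromℕ n) ⊓ q)
      ≤⟨ prefixSum-split q (λ i _ → head-row i) (λ i _ → ⊓-monoˡ-≤ q (d↓ i (fromℕ n) (≤fromℕ i))) ⟩
    sum (λ i → d i ⊓ q) +ℕ (suc n ⊓ q) *ℕ (d zero ∸ q)
      ≤⟨ +-monoʳ-≤ (sum (λ i → d i ⊓ q)) (excess≤slack q bound) ⟩
    sum (λ i → d i ⊓ q) +ℕ (suc n ∸ q) *ℕ (d (fromℕ n) ⊓ q)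
      ∎)
    where
    head-row : ∀ i → d i ≤ℕ d i ⊓ q +ℕ (d zero ∸ q)
    head-row i = begin
      d i                       ≡⟨ m⊓n+n∸m≡n q (d i) ⟨
      q ⊓ d i +ℕ (d i ∸ q)      ≤⟨ +-mono-≤ (≤-reflexive (⊓-comm q (d i))) (∸-monoˡ-≤ q (d↓ zero i z≤n)) ⟩
      d i ⊓ q +ℕ (d zero ∸ q)   ∎

open Realisation using (gale-ryser; degree-bound⇒gale-ryser)

ℕtoℚ≡mkℚ : ∀ n → ℕtoℚ n ≡ mkℚ (+ n) 0 (Coprimality.sym (Coprimality.1-coprimeTo n))
ℕtoℚ≡mkℚ n = ℚ.normalize-coprime (Coprimality.sym (Coprimality.1-coprimeTo n))

ℕtoℚ-+ : ∀ x y → ℕtoℚ x + ℕtoℚ y ≡ ℕtoℚ (x ℕ.+ y)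
ℕtoℚ-+ x y rewrite ℕtoℚ≡mkℚ x | ℕtoℚ≡mkℚ y =
  cong (_/ 1) (trans (cong₂ ℤ._+_ (ℤ.*-identityʳ (+ x)) (ℤ.*-identityʳ (+ y))) (sym (ℤ.pos-+ x y)))

ℕtoℚ-* : ∀ x y → ℕtoℚ x * ℕtoℚ y ≡ ℕtoℚ (x ℕ.* y)
ℕtoℚ-* x y rewrite ℕtoℚ≡mkℚ x | ℕtoℚ≡mkℚ y = cong (_/ 1) (sym (ℤ.pos-* x y))

ℕtoℚ-mono-≤ : ∀ {x y} → x ℕ.≤ y → ℕtoℚ x ≤ ℕtoℚ y
ℕtoℚ-mono-≤ {x} {y} x≤y rewrite ℕtoℚ≡mkℚ x | ℕtoℚ≡mkℚ y =
  *≤* (subst₂ ℤ._≤_ (sym (ℤ.*-identityʳ (+ x))) (sym (ℤ.*-identityʳ (+ y))) (+≤+ x≤y))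

ℕtoℚ-cancel-≤ : ∀ {x y} → ℕtoℚ x ≤ ℕtoℚ y → x ℕ.≤ y
ℕtoℚ-cancel-≤ {x} {y} x≤y rewrite ℕtoℚ≡mkℚ x | ℕtoℚ≡mkℚ y with x≤y
... | *≤* x≤y = ℤ.drop‿+≤+ (subst₂ ℤ._≤_ (ℤ.*-identityʳ (+ x)) (ℤ.*-identityʳ (+ y)) x≤y)

ℕtoℚ-square-bound : ∀ Δ δ m →
  (ℕtoℚ Δ + ℕtoℚ δ) * (ℕtoℚ Δ + ℕtoℚ δ) ≤ ℕtoℚ 4 * ℕtoℚ δ * ℕtoℚ m →
  (Δ ℕ.+ δ) ℕ.* (Δ ℕ.+ δ) ℕ.≤ 4 ℕ.* δ ℕ.* m
ℕtoℚ-square-bound Δ δ m = ℕtoℚ-cancel-≤ ∘ subst₂ _≤_ square product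
  where
  square : (ℕtoℚ Δ + ℕtoℚ δ) * (ℕtoℚ Δ + ℕtoℚ δ) ≡ ℕtoℚ ((Δ ℕ.+ δ) ℕ.* (Δ ℕ.+ δ))
  square = trans (cong (λ s → s * s) (ℕtoℚ-+ Δ δ)) (ℕtoℚ-* (Δ ℕ.+ δ) (Δ ℕ.+ δ))
  product : ℕtoℚ 4 * ℕtoℚ δ * ℕtoℚ m ≡ ℕtoℚ (4 ℕ.* δ ℕ.* m)
  product = trans (cong (_* ℕtoℚ m) (ℕtoℚ-* 4 δ)) (ℕtoℚ-* (4 ℕ.* δ) m)

0≤q-p : ∀ {p q} → p ≤ q → 0ℚ ≤ q + - p
0≤q-p {p} p≤q = ℚ.≤-trans (ℚ.≤-reflexive (sym (ℚ.+-inverseʳ p))) (ℚ.+-monoˡ-≤ (- p) p≤q)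

ratio-bound⇒square-bound : ∀ {a X Y M} → 1ℚ ≤ a → 0ℚ ≤ Y → Y ≤ X → X ≤ a * Y →
  X * ((a + 1ℚ) * (a + 1ℚ)) ≤ ℕtoℚ 4 * a * M → (X + Y) * (X + Y) ≤ ℕtoℚ 4 * Y * M
ratio-bound⇒square-bound {a} {X} {Y} {M} 1≤a 0≤Y Y≤X X≤aY bound = ℚ.*-cancelˡ-≤-pos a {{a-positive}} (begin
  a * ((X + Y) * (X + Y))                      ≤⟨ ℚ.≤-trans (ℚ.≤-reflexive (sym (ℚ.+-identityʳ (a * ((X + Y) * (X + Y)))))) (ℚ.+-monoʳ-≤ (a * ((X + Y) * (X + Y))) 0≤defect) ⟩
  a * ((X + Y) * (X + Y)) + (a * Y + - X) * (a * X + - Y)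
                                               ≡⟨ identity a X Y ⟩
  Y * (X * ((a + 1ℚ) * (a + 1ℚ)))              ≤⟨ ℚ.*-monoˡ-≤-nonNeg Y {{nonNegative 0≤Y}} bound ⟩
  Y * (ℕtoℚ 4 * a * M)                         ≡⟨ rearrange a Y M (ℕtoℚ 4) ⟩
  a * (ℕtoℚ 4 * Y * M)                         ∎)
  where
  open ℚ.≤-Reasoning
  open +-*-Solver
  a-positive : Positive a
  a-positive = positive (ℚ.<-≤-trans (ℚ.positive⁻¹ 1ℚ) 1≤a)
  Y≤aX : Y ≤ a * X
  Y≤aX = ℚ.≤-trans Y≤X (ℚ.≤-trans (ℚ.≤-reflexive (sym (ℚ.*-identityˡ X)))
           (ℚ.*-monoʳ-≤-nonNeg X {{nonNegative (ℚ.≤-trans 0≤Y Y≤X)}} 1≤a))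
  0≤defect : 0ℚ ≤ (a * Y + - X) * (a * X + - Y)
  0≤defect = ℚ.nonNegative⁻¹ ((a * Y + - X) * (a * X + - Y))
    {{ℚ.nonNeg*nonNeg⇒nonNeg (a * Y + - X) {{nonNegative (0≤q-p X≤aY)}} (a * X + - Y) {{nonNegative (0≤q-p Y≤aX)}}}}
  identity : ∀ a X Y → a * ((X + Y) * (X + Y)) + (a * Y + - X) * (a * X + - Y) ≡ Y * (X * ((a + 1ℚ) * (a + 1ℚ)))
  identity = solve 3 (λ a X Y → a :* ((X :+ Y) :* (X :+ Y)) :+ (a :* Y :+ :- X) :* (a :* X :+ :- Y)
                               := Y :* (X :* ((a :+ con 1ℚ) :* (a :+ con 1ℚ)))) refl
  rearrange : ∀ a Y M F → Y * (F * a * M) ≡ a * (F * Y * M)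
  rearrange = solve 4 (λ a Y M F → Y :* (F :* a :* M) := a :* (F :* Y :* M)) refl

corollary3 : (n : ℕ) → (d : Fin (suc n) → ℕ) → NonIncreasing d →
    ((a : ℚ) → 1ℚ ≤ a →
      ℕtoℚ (d zero) ≤ a * ℕtoℚ (d (fromℕ n)) →
      ℕtoℚ (d zero) * ((a + 1ℚ) * (a + 1ℚ)) ≤ ℕtoℚ 4 * a * ℕtoℚ (suc n) →
      Σ (BipartiteGraph (suc n)) λ E → HasBidegrees E d)
    ×
    (ℕtoℚ (d zero) ≤ ℕtoℚ 2 * ℕtoℚ (d (fromℕ n)) →
      ℕtoℚ (d zero) * ℕtoℚ 9 ≤ ℕtoℚ 8 * ℕtoℚ (suc n) →
      Σ (BipartiteGraph (suc n)) λ E → HasBidegrees E d)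
corollary3 n d d↓ = realise , realise (ℕtoℚ 2) (ℕtoℚ-mono-≤ {1} {2} (ℕ.s≤s ℕ.z≤n))
  where
  realise : (a : ℚ) → 1ℚ ≤ a →
    ℕtoℚ (d zero) ≤ a * ℕtoℚ (d (fromℕ n)) →
    ℕtoℚ (d zero) * ((a + 1ℚ) * (a + 1ℚ)) ≤ ℕtoℚ 4 * a * ℕtoℚ (suc n) →
    Σ (BipartiteGraph (suc n)) λ E → HasBidegrees E d
  realise a 1≤a Δ≤aδ bound = gale-ryser d d d↓ refl (degree-bound⇒gale-ryser d↓ (ℕtoℚ-square-bound (d zero) (d (fromℕ n)) (suc n)
    (ratio-bound⇒square-bound 1≤a 0≤δ δ≤Δ Δ≤aδ bound)))
    where
    0≤δ : 0ℚ ≤ ℕtoℚ (d (fromℕ n))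
    0≤δ = ℕtoℚ-mono-≤ {0} {d (fromℕ n)} ℕ.z≤n
    δ≤Δ : ℕtoℚ (d (fromℕ n)) ≤ ℕtoℚ (d zero)
    δ≤Δ = ℕtoℚ-mono-≤ {d (fromℕ n)} {d zero} (d↓ zero (fromℕ n) ℕ.z≤n)
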